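{- Let $S$ be a set, $\sigma$ a binary relation on $S$, $\mathcal{G}\subseteq\wp(S)$ a neighborhood granulation on $S$ with associated map $\gamma:S\to\mathcal{G}$, and let $\mathcal{I}_\sigma(S)$ be the set of $\sigma$-ideals of $(S,\sigma)$. For $X\subseteq S$ define $X^{l_*}=\{a\in X: \gamma(a)\cap X^c\in\mathcal{I}_\sigma(S)\}$ and $X^{u_*}=\{a\in S: \gamma(a)\cap X\notin\mathcal{I}_\sigma(S)\}\cup X$, where $X^c=S\setminus X$. Then for all $A\subseteq S$: $A^{l_*}\subseteq A\subseteq A^{u_*}$; $A^{l_*l_*}\subseteq A^{l_*}$; $A^{u_*}\subseteq A^{u_*u_*}$; $\emptyset^{l_*}=\emptyset=\emptyset^{u_*}$; and $S^{l_*}=S=S^{u_*}$.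
   Context: For $a,b\in S$, $U(a,b)=\{x\in S:\sigma ax \text{ and } \sigma bx\}$. A $\sigma$-ideal is a subset $K\subset S$ such that (i) for all $x\in S$ and $a\in K$, $\sigma xa$ implies $x\in K$, and (ii) for all $a,b\in K$, $U(a,b)\cap K\neq\emptyset$. A neighborhood granulation on $S$ is a family $\mathcal{G}\subseteq\wp(S)$ together with a map $\gamma:S\to\mathcal{G}$ that is surjective onto $\mathcal{G}$ and satisfies $\bigcup_{x\in S}\gamma(x)=S$. -}

module Defs where

open import Level using (0ℓ) renaming (suc to lsuc)
open import Data.Product using (Σ; ∃; _×_; _,_)
open import Relation.Nullary using (¬_)
open import Relation.Unary using (Pred; _∈_; _∉_; _∩_; _∪_; ∁; _≐_)
open import Relation.Binary using (Rel)

Subset : Set → Set₁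
Subset S = Pred S 0ℓ

Uσ : {S : Set} (σ : Rel S 0ℓ) → S → S → Subset S
Uσ σ a b x = σ a x × σ b x

record IsσIdeal {S : Set} (σ : Rel S 0ℓ) (K : Subset S) : Set where
  field
    downward : ∀ x a → a ∈ K → σ x a → x ∈ K
    directed : ∀ a b → a ∈ K → b ∈ K → ∃ λ x → x ∈ Uσ σ a b × x ∈ K

record IsNeighborhoodGranulation {S : Set} (𝒢 : Pred (Subset S) (lsuc 0ℓ))
         (γ : S → Subset S) : Set₁ where
  field
    γ-into   : ∀ x → γ x ∈ 𝒢
    γ-onto   : ∀ G → G ∈ 𝒢 → ∃ λ x → γ x ≐ G
    γ-covers : ∀ s → ∃ λ x → s ∈ γ x

lowerStar : {S : Set} (σ : Rel S 0ℓ) (γ : S → Subset S) → Subset S → Subset S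
lowerStar σ γ X a = a ∈ X × IsσIdeal σ (γ a ∩ ∁ X)

upperStar : {S : Set} (σ : Rel S 0ℓ) (γ : S → Subset S) → Subset S → Subset S
upperStar σ γ X = (λ a → ¬ IsσIdeal σ (γ a ∩ X)) ∪ X

module Submission where

open import Defs
open import Level using (0ℓ) renaming (suc to lsuc)
open import Data.Empty using (⊥-elim)
open import Data.Product using (_×_; _,_; proj₁; proj₂)
open import Data.Sum using (inj₁; inj₂)
open import Data.Unit using (tt)
open import Relation.Unary using (Pred; _⊆_; ∅; U; Empty)
open import Relation.Binary using (Rel)

-- l* is deflationary and u* inflationary by definition; the remaining claims only need
-- that an empty set (here γ(a) ∩ ∅ and γ(a) ∩ ∁ S) is vacuously a σ-ideal.

empty-isσIdeal : {S : Set} (σ : Rel S 0ℓ) {K : Subset S} → Empty K → IsσIdeal σ K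
empty-isσIdeal σ {K} empty = record
  { downward = λ _ a a∈K _ → ⊥-elim (empty a a∈K)
  ; directed = λ a _ a∈K _ → ⊥-elim (empty a a∈K)
  }

module Approximations {S : Set} (σ : Rel S 0ℓ) (γ : S → Subset S) where

  lowerStar-deflationary : (X : Subset S) → lowerStar σ γ X ⊆ X
  lowerStar-deflationary X = proj₁

  upperStar-inflationary : (X : Subset S) → X ⊆ upperStar σ γ X
  upperStar-inflationary X = inj₂

  upperStar-∅ : upperStar σ γ ∅ ⊆ ∅
  upperStar-∅ (inj₁ notIdeal) = notIdeal (empty-isσIdeal σ (λ _ → proj₂))
  upperStar-∅ (inj₂ ())

  U⊆lowerStar-U : U ⊆ lowerStar σ γ U
  U⊆lowerStar-U _ = tt , empty-isσIdeal σ (λ _ x∈γa∖U → proj₂ x∈γa∖U tt)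

mainTheorem4 : (S : Set) (σ : Rel S 0ℓ) (𝒢 : Pred (Subset S) (lsuc 0ℓ)) (γ : S → Subset S)
    → IsNeighborhoodGranulation 𝒢 γ
    → (∀ (A : Subset S) → (lowerStar σ γ A ⊆ A × A ⊆ upperStar σ γ A)
    × lowerStar σ γ (lowerStar σ γ A) ⊆ lowerStar σ γ A
    × upperStar σ γ A ⊆ upperStar σ γ (upperStar σ γ A))
    × ((lowerStar σ γ ∅ ⊆ ∅ × ∅ ⊆ lowerStar σ γ ∅) × (upperStar σ γ ∅ ⊆ ∅ × ∅ ⊆ upperStar σ γ ∅))
    × ((lowerStar σ γ U ⊆ U × U ⊆ lowerStar σ γ U) × (upperStar σ γ U ⊆ U × U ⊆ upperStar σ γ U))
mainTheorem4 S σ 𝒢 γ _ =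
    (λ A → (lowerStar-deflationary A , upperStar-inflationary A)
         , lowerStar-deflationary (lowerStar σ γ A)
         , upperStar-inflationary (upperStar σ γ A))
  , ((lowerStar-deflationary ∅ , λ ()) , (upperStar-∅ , λ ()))
  , ((λ _ → tt) , U⊆lowerStar-U) , ((λ _ → tt) , upperStar-inflationary U)
  where open Approximations σ γ
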